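{- Let $n,s,k$ be integers with $k\ge 1$ and $k+1\le s\le n$. Then $$p^1_{n;\le s;k}=\sum_{i=1}^{s-k-1}\binom{n-1}{s-i-k-1}\,p_{n+k-s+i;\le i}\;p^1_{s-k-i,\,s-i-1;\le s-i-1}.$$
   Context: Parking model: there are $m$ parking spaces in a line, numbered $1,\dots,m$. A preference set of length $n$ is a sequence $(a_1,\dots,a_n)$ of integers with $1\le a_i\le m$; cars $1,\dots,n$ arrive in order, car $i$ parks in the first unoccupied space numbered $\ge a_i$ if one exists, otherwise it fails to park. A $k$-flaw preference set is one in which exactly $k$ cars fail to park; a $0$-flaw one is a parking function. $p_{n,m;\le s;k}$ is the number of $k$-flaw preference sets of length $n$ with $m$ spaces and all $a_i\le s$, and $p^l_{n,m;\le s;k}$ the number of those with $a_1=l$. Conventions: omitted $k$ means $k=0$; omitted $m$ means $m=n$. Thus $p^1_{n;\le s;k}$ counts $k$-flaw preference sets with $n$ cars, $n$ spaces, entries $\le s$ and $a_1=1$; $p_{j;\le i}$ counts parking functions of length $j$ with $j$ spaces and entries $\le i$; $p^1_{j,m;\le t}$ counts parking functions of length $j$ with $m$ spaces, entries $\le t$ and first entry $1$. -}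

module Defs where

open import Data.Nat using (ℕ; zero; suc; _+_; _∸_; _≤?_; _≟_)
open import Data.Nat.Combinatorics using (_C_)
open import Data.Bool using (Bool; true; false)
open import Data.Maybe using (Maybe; just; nothing)
import Data.Maybe as Maybe
open import Data.List using (List; []; _∷_; [_]; length; map; filter; concatMap; applyUpTo; replicate)
open import Data.Nat.ListAction using (sum)
open import Relation.Binary.PropositionalEquality using (_≡_)
open import Relation.Nullary using (yes; no; Dec)
open import Data.Empty using (⊥)

-- Occupancy of spaces 1..m as a list of Bools (true = occupied).
-- tryPark d occ : the car whose preference is space d+1 parks in the
-- first unoccupied space with index ≥ d+1; nothing if no such space.
tryPark : ℕ → List Bool → Maybe (List Bool)
tryPark zero [] = nothing
tryPark zero (false ∷ bs) = just (true ∷ bs)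
tryPark zero (true ∷ bs) = Maybe.map (true ∷_) (tryPark zero bs)
tryPark (suc d) [] = nothing
tryPark (suc d) (b ∷ bs) = Maybe.map (b ∷_) (tryPark d bs)

flawsFrom : List Bool → List ℕ → ℕ
flawsFrom occ [] = 0
flawsFrom occ (a ∷ as) with tryPark (a ∸ 1) occ
... | just occ' = flawsFrom occ' as
... | nothing = suc (flawsFrom occ as)

flaws : ℕ → List ℕ → ℕ
flaws m as = flawsFrom (replicate m false) as

values : ℕ → ℕ → List ℕ
values m s = filter (λ a → a ≤? s) (applyUpTo suc m)

seqs : ℕ → List ℕ → List (List ℕ)
seqs zero vs = [ [] ]
seqs (suc n) vs = concatMap (λ a → map (a ∷_) (seqs n vs)) vs

prefSets : ℕ → ℕ → ℕ → List (List ℕ)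
prefSets n m s = seqs n (values m s)

FirstIs : ℕ → List ℕ → Set
FirstIs l [] = ⊥
FirstIs l (a ∷ _) = a ≡ l

firstIs? : (l : ℕ) → (as : List ℕ) → Dec (FirstIs l as)
firstIs? l [] = no (λ ())
firstIs? l (a ∷ _) = a ≟ l

p : ℕ → ℕ → ℕ → ℕ → ℕ
p n m s k = length (filter (λ as → flaws m as ≟ k) (prefSets n m s))

pˡ : ℕ → ℕ → ℕ → ℕ → ℕ → ℕ
pˡ l n m s k = length (filter (λ as → flaws m as ≟ k) (filter (firstIs? l) (prefSets n m s)))

Σ₁ : ℕ → (ℕ → ℕ) → ℕ
Σ₁ N f = sum (map f (applyUpTo suc N))

-- Let a be a k-flaw preference set with a₁ = 1 and entries ≤ s, and let d + 1 be its last empty space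
-- (one exists since k ≥ 1). No car prefers d + 1, so the cars preferring 1..d park without a flaw inside the
-- first d spaces, while the cars preferring d + 2..s fill the last n − d − 1 spaces and produce all k flaws.
-- Shifted down by d + 1, the latter are a k-flaw set on M = n − d − 1 spaces with M + k cars, i.e. a parking
-- function on M + k spaces. With i = s − d − 1 the two parts are counted by p¹_{s−k−i, s−i−1; ≤ s−i−1} and
-- p_{n+k−s+i; ≤ i}, and the binomial coefficient chooses which of the cars 2..n form the first part.

module Submission where

open import Defs
open import Data.Nat
open import Data.Nat.Properties
open import Data.Nat.Combinatorics using (_C_; k>n⇒nCk≡0; nCk+nC[k+1]≡[n+1]C[k+1])
open import Data.Nat.ListAction using (sum)
open import Data.Nat.ListAction.Properties using (sum-++)
open import Data.Nat.Tactic.RingSolver using (solve-∀)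
open import Data.Bool using (Bool; true; false; if_then_else_)
open import Data.Maybe using (Maybe; just; nothing)
import Data.Maybe as Maybe
import Data.Maybe.Properties as Maybeₚ
open import Data.List using (List; []; _∷_; length; map; filter; concat; applyUpTo; replicate; _++_)
open import Data.List.Properties
  using (map-++; map-∘; length-++; length-replicate; ∷-injectiveʳ; filter-++; filter-accept; filter-reject; ++-identityʳ)
open import Data.Product using (∃; ∃₂; _×_; _,_; proj₁; proj₂; map₁; map₂)
open import Data.Sum using (_⊎_; inj₁; inj₂)
open import Data.List.Relation.Unary.All using (All; []; _∷_)
import Data.List.Relation.Unary.All as All
open import Data.Empty using (⊥-elim)
open import Relation.Nullary using (yes; no; Dec; does; ¬_)
open import Relation.Unary using (Pred; Decidable)
open import Relation.Binary.PropositionalEquality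

-- Finite sums

∑ : List ℕ → (ℕ → ℕ) → ℕ
∑ vs f = sum (map f vs)

∑seq : ℕ → List ℕ → (List ℕ → ℕ) → ℕ
∑seq zero    vs f = f []
∑seq (suc n) vs f = ∑ vs (λ x → ∑seq n vs (λ b → f (x ∷ b)))

range : ℕ → ℕ → List ℕ
range a zero    = []
range a (suc b) = suc a ∷ range (suc a) b

∑-cong : ∀ vs {f g : ℕ → ℕ} → (∀ x → f x ≡ g x) → ∑ vs f ≡ ∑ vs g
∑-cong []       f≗g = refl
∑-cong (v ∷ vs) f≗g = cong₂ _+_ (f≗g v) (∑-cong vs f≗g)

∑-cong-range : ∀ a b {f g : ℕ → ℕ} → (∀ x → a < x → x ≤ a + b → f x ≡ g x) → ∑ (range a b) f ≡ ∑ (range a b) g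
∑-cong-range a zero    f≗g = refl
∑-cong-range a (suc b) f≗g = cong₂ _+_
  (f≗g (suc a) ≤-refl (subst (suc a ≤_) (sym (+-suc a b)) (s≤s (m≤m+n a b))))
  (∑-cong-range (suc a) b λ x a<x x≤ → f≗g x (<⇒≤ a<x) (subst (x ≤_) (sym (+-suc a b)) x≤))

∑-zero : ∀ vs → ∑ vs (λ _ → 0) ≡ 0
∑-zero []       = refl
∑-zero (v ∷ vs) = ∑-zero vs

∑-+ : ∀ vs (f g : ℕ → ℕ) → ∑ vs (λ x → f x + g x) ≡ ∑ vs f + ∑ vs g
∑-+ []       f g = refl
∑-+ (v ∷ vs) f g = trans (cong (f v + g v +_) (∑-+ vs f g)) (+-interchange (f v) (g v) (∑ vs f) (∑ vs g))
  where
  +-interchange : ∀ a b c d → a + b + (c + d) ≡ a + c + (b + d)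
  +-interchange = solve-∀

∑-*ˡ : ∀ vs c (f : ℕ → ℕ) → ∑ vs (λ x → c * f x) ≡ c * ∑ vs f
∑-*ˡ []       c f = sym (*-zeroʳ c)
∑-*ˡ (v ∷ vs) c f = trans (cong (c * f v +_) (∑-*ˡ vs c f)) (sym (*-distribˡ-+ c (f v) (∑ vs f)))

∑-*ʳ : ∀ vs c (f : ℕ → ℕ) → ∑ vs (λ x → f x * c) ≡ ∑ vs f * c
∑-*ʳ vs c f = trans (∑-cong vs (λ x → *-comm (f x) c)) (trans (∑-*ˡ vs c f) (*-comm c _))

∑-++ : ∀ us vs f → ∑ (us ++ vs) f ≡ ∑ us f + ∑ vs f
∑-++ us vs f = trans (cong sum (map-++ f us vs)) (sum-++ (map f us) (map f vs))

∑-swap : ∀ us vs (f : ℕ → ℕ → ℕ) → ∑ us (λ u → ∑ vs (f u)) ≡ ∑ vs (λ v → ∑ us (λ u → f u v))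
∑-swap []       vs f = sym (∑-zero vs)
∑-swap (u ∷ us) vs f =
  trans (cong (∑ vs (f u) +_) (∑-swap us vs f)) (sym (∑-+ vs (f u) (λ v → ∑ us (λ u → f u v))))

range-++ : ∀ a b c → range a (b + c) ≡ range a b ++ range (a + b) c
range-++ a zero    c = cong (λ z → range z c) (sym (+-identityʳ a))
range-++ a (suc b) c = cong (suc a ∷_) (trans (range-++ (suc a) b c) (cong (λ z → range (suc a) b ++ range z c) (sym (+-suc a b))))

∑-range-shift : ∀ a b (g : ℕ → ℕ) → ∑ (range a b) g ≡ ∑ (range 0 b) (λ y → g (a + y))
∑-range-shift a zero    g = refl
∑-range-shift a (suc b) g = cong₂ _+_ (cong g (sym (+-comm a 1)))
  (trans (∑-range-shift (suc a) b g)
    (sym (trans (∑-range-shift 1 b (λ y → g (a + y))) (∑-cong (range 0 b) (λ y → cong g (+-suc a y))))))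

∑-single : ∀ a b (f : ℕ → ℕ) i₀ → a < i₀ → i₀ ≤ a + b → (∀ i → a < i → i ≤ a + b → i ≢ i₀ → f i ≡ 0) →
  ∑ (range a b) f ≡ f i₀
∑-single a zero    f i₀ a<i₀ i₀≤ _ = ⊥-elim (<-irrefl refl (≤-trans a<i₀ (subst (i₀ ≤_) (+-identityʳ a) i₀≤)))
∑-single a (suc b) f i₀ a<i₀ i₀≤ others with suc a ≟ i₀
... | yes refl = trans (cong (f (suc a) +_) rest-zero) (+-identityʳ _)
  where
  rest-zero : ∑ (range (suc a) b) f ≡ 0
  rest-zero = trans (∑-cong-range (suc a) b λ i a<i i≤ → others i (<⇒≤ a<i) (subst (i ≤_) (sym (+-suc a b)) i≤) (>⇒≢ a<i))
    (∑-zero (range (suc a) b))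
... | no a+1≢i₀ = trans
  (cong (_+ ∑ (range (suc a) b) f) (others (suc a) ≤-refl (subst (suc a ≤_) (sym (+-suc a b)) (s≤s (m≤m+n a b))) a+1≢i₀))
  (∑-single (suc a) b f i₀ (≤∧≢⇒< a<i₀ a+1≢i₀) (subst (i₀ ≤_) (+-suc a b) i₀≤)
    λ i a<i i≤ → others i (<⇒≤ a<i) (subst (i ≤_) (sym (+-suc a b)) i≤))

∑seq-cong : ∀ n vs {f g : List ℕ → ℕ} → (∀ a → f a ≡ g a) → ∑seq n vs f ≡ ∑seq n vs g
∑seq-cong zero    vs f≗g = f≗g []
∑seq-cong (suc n) vs f≗g = ∑-cong vs (λ x → ∑seq-cong n vs (λ b → f≗g (x ∷ b)))

∑seq-cong-range : ∀ n m {f g : List ℕ → ℕ} → (∀ a → All (_≤ m) a → length a ≡ n → f a ≡ g a) →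
  ∑seq n (range 0 m) f ≡ ∑seq n (range 0 m) g
∑seq-cong-range zero    m f≗g = f≗g [] [] refl
∑seq-cong-range (suc n) m f≗g =
  ∑-cong-range 0 m (λ x _ x≤m → ∑seq-cong-range n m (λ b b≤m ∣b∣ → f≗g (x ∷ b) (x≤m ∷ b≤m) (cong suc ∣b∣)))

∑seq-zero : ∀ n vs → ∑seq n vs (λ _ → 0) ≡ 0
∑seq-zero zero    vs = refl
∑seq-zero (suc n) vs = trans (∑-cong vs (λ x → ∑seq-zero n vs)) (∑-zero vs)

∑seq-*ˡ : ∀ n vs c (f : List ℕ → ℕ) → ∑seq n vs (λ a → c * f a) ≡ c * ∑seq n vs f
∑seq-*ˡ zero    vs c f = refl
∑seq-*ˡ (suc n) vs c f = trans (∑-cong vs (λ x → ∑seq-*ˡ n vs c (λ b → f (x ∷ b)))) (∑-*ˡ vs c _)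

∑seq-∑-swap : ∀ n vs us (f : List ℕ → ℕ → ℕ) → ∑seq n vs (λ a → ∑ us (f a)) ≡ ∑ us (λ u → ∑seq n vs (λ a → f a u))
∑seq-∑-swap zero    vs us f = refl
∑seq-∑-swap (suc n) vs us f =
  trans (∑-cong vs (λ x → ∑seq-∑-swap n vs us (λ b → f (x ∷ b))))
        (∑-swap vs us (λ x u → ∑seq n vs (λ b → f (x ∷ b) u)))

sum-map-seqs : ∀ n vs (f : List ℕ → ℕ) → sum (map f (seqs n vs)) ≡ ∑seq n vs f
sum-map-seqs zero    vs f = +-identityʳ (f [])
sum-map-seqs (suc n) vs f = trans (sum-concat vs) (∑-cong vs (λ x → sum-map-seqs n vs (λ b → f (x ∷ b))))
  where
  sum-concat : ∀ us → sum (map f (concat (map (λ x → map (x ∷_) (seqs n vs)) us))) ≡ ∑ us (λ x → sum (map (λ a → f (x ∷ a)) (seqs n vs)))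
  sum-concat []       = refl
  sum-concat (u ∷ us) = trans (cong sum (map-++ f (map (u ∷_) (seqs n vs)) _))
    (trans (sum-++ (map f (map (u ∷_) (seqs n vs))) _) (cong₂ _+_ (cong sum (sym (map-∘ (seqs n vs)))) (sum-concat us)))

𝟙 : ∀ {p} {P : Set p} → Dec P → ℕ
𝟙 P? = if does P? then 1 else 0

length-filter-𝟙 : ∀ {p} {A : Set} {P : Pred A p} (P? : Decidable P) xs → length (filter P? xs) ≡ sum (map (λ x → 𝟙 (P? x)) xs)
length-filter-𝟙 P? []       = refl
length-filter-𝟙 P? (x ∷ xs) with does (P? x)
... | true  = cong suc (length-filter-𝟙 P? xs)
... | false = length-filter-𝟙 P? xs

length-filter²-𝟙 : ∀ {p q} {A : Set} {P : Pred A p} {Q : Pred A q} (P? : Decidable P) (Q? : Decidable Q) xs →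
  length (filter Q? (filter P? xs)) ≡ sum (map (λ x → 𝟙 (P? x) * 𝟙 (Q? x)) xs)
length-filter²-𝟙 P? Q? []       = refl
length-filter²-𝟙 P? Q? (x ∷ xs) with does (P? x)
... | false = length-filter²-𝟙 P? Q? xs
... | true with does (Q? x)
...   | true  = cong suc (length-filter²-𝟙 P? Q? xs)
...   | false = length-filter²-𝟙 P? Q? xs

𝟙-yes : ∀ {p} {P : Set p} (P? : Dec P) → P → 𝟙 P? ≡ 1
𝟙-yes (yes _) _ = refl
𝟙-yes (no ¬p) p = ⊥-elim (¬p p)

𝟙-no : ∀ {p} {P : Set p} (P? : Dec P) → ¬ P → 𝟙 P? ≡ 0
𝟙-no (yes p) ¬p = ⊥-elim (¬p p)
𝟙-no (no _)  _  = refl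

𝟙≢0⇒ : ∀ {p} {P : Set p} (P? : Dec P) → 𝟙 P? ≢ 0 → P
𝟙≢0⇒ (yes p) _  = p
𝟙≢0⇒ (no _)  ≢0 = ⊥-elim (≢0 refl)

𝟙-cong : ∀ {p q} {P : Set p} {Q : Set q} (P? : Dec P) (Q? : Dec Q) → (P → Q) → (Q → P) → 𝟙 P? ≡ 𝟙 Q?
𝟙-cong (yes p) (yes q) _ _ = refl
𝟙-cong (yes p) (no ¬q) f _ = ⊥-elim (¬q (f p))
𝟙-cong (no ¬p) (yes q) _ g = ⊥-elim (¬p (g q))
𝟙-cong (no ¬p) (no ¬q) _ _ = refl

-- Parking mechanics

flawsFrom-park : ∀ {a occ occ′} as → tryPark (a ∸ 1) occ ≡ just occ′ → flawsFrom occ (a ∷ as) ≡ flawsFrom occ′ as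
flawsFrom-park {a} {occ} as parks with tryPark (a ∸ 1) occ
flawsFrom-park as refl | just _ = refl

flawsFrom-fail : ∀ {a occ} as → tryPark (a ∸ 1) occ ≡ nothing → flawsFrom occ (a ∷ as) ≡ suc (flawsFrom occ as)
flawsFrom-fail {a} {occ} as fails with tryPark (a ∸ 1) occ
flawsFrom-fail as refl | nothing = refl

parkAll : List Bool → List ℕ → List Bool
parkAll occ []       = occ
parkAll occ (a ∷ as) with tryPark (a ∸ 1) occ
... | just occ′ = parkAll occ′ as
... | nothing   = parkAll occ as

parkAll-park : ∀ {a occ occ′} as → tryPark (a ∸ 1) occ ≡ just occ′ → parkAll occ (a ∷ as) ≡ parkAll occ′ as
parkAll-park {a} {occ} as parks with tryPark (a ∸ 1) occ
parkAll-park as refl | just _ = refl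

parkAll-fail : ∀ {a occ} as → tryPark (a ∸ 1) occ ≡ nothing → parkAll occ (a ∷ as) ≡ parkAll occ as
parkAll-fail {a} {occ} as fails with tryPark (a ∸ 1) occ
parkAll-fail as refl | nothing = refl

occupied : List Bool → ℕ
occupied []           = 0
occupied (true  ∷ bs) = suc (occupied bs)
occupied (false ∷ bs) = occupied bs

occupied-empty : ∀ m → occupied (replicate m false) ≡ 0
occupied-empty zero    = refl
occupied-empty (suc m) = occupied-empty m

occupied-full : ∀ m → occupied (replicate m true) ≡ m
occupied-full zero    = refl
occupied-full (suc m) = cong suc (occupied-full m)

occupied≤length : ∀ bs → occupied bs ≤ length bs
occupied≤length []           = z≤n
occupied≤length (true  ∷ bs) = s≤s (occupied≤length bs)
occupied≤length (false ∷ bs) = m≤n⇒m≤1+n (occupied≤length bs)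

occupied≡length⇒full : ∀ bs → occupied bs ≡ length bs → bs ≡ replicate (length bs) true
occupied≡length⇒full []           _ = refl
occupied≡length⇒full (true  ∷ bs) e = cong (true ∷_) (occupied≡length⇒full bs (suc-injective e))
occupied≡length⇒full (false ∷ bs) e = ⊥-elim (<-irrefl e (s≤s (occupied≤length bs)))

replicate-+ : ∀ {A : Set} m k (b : A) → replicate (m + k) b ≡ replicate m b ++ replicate k b
replicate-+ zero    k b = refl
replicate-+ (suc m) k b = cong (b ∷_) (replicate-+ m k b)

lastEmpty : ∀ bs → occupied bs < length bs → ∃₂ λ x m → bs ≡ x ++ false ∷ replicate m true
lastEmpty (b ∷ bs) occ< with occupied bs <? length bs
... | yes occ<′ = let x , m , bs≡ = lastEmpty bs occ<′ in b ∷ x , m , cong (b ∷_) bs≡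
lastEmpty (true ∷ bs)  occ< | no occ≮ = ⊥-elim (occ≮ (s≤s⁻¹ occ<))
lastEmpty (false ∷ bs) occ< | no occ≮ =
  [] , length bs , cong (false ∷_) (occupied≡length⇒full bs (≤-antisym (occupied≤length bs) (≮⇒≥ occ≮)))

replicate-true≢++-false : ∀ m y z → replicate m true ≢ y ++ false ∷ z
replicate-true≢++-false zero    []      _ ()
replicate-true≢++-false zero    (_ ∷ _) _ ()
replicate-true≢++-false (suc m) []      _ ()
replicate-true≢++-false (suc m) (_ ∷ y) z e = replicate-true≢++-false m y z (∷-injectiveʳ e)

lastEmpty-unique : ∀ x x′ m m′ → x ++ false ∷ replicate m true ≡ x′ ++ false ∷ replicate m′ true → length x ≡ length x′
lastEmpty-unique []      []       m m′ _ = refl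
lastEmpty-unique []      (_ ∷ x′) m m′ e = ⊥-elim (replicate-true≢++-false m x′ _ (∷-injectiveʳ e))
lastEmpty-unique (_ ∷ x) []       m m′ e = ⊥-elim (replicate-true≢++-false m′ x _ (sym (∷-injectiveʳ e)))
lastEmpty-unique (_ ∷ x) (_ ∷ x′) m m′ e = cong suc (lastEmpty-unique x x′ m m′ (∷-injectiveʳ e))

++-cancelˡ-length : ∀ {A : Set} (xs xs′ : List A) {ys ys′} → length xs ≡ length xs′ → xs ++ ys ≡ xs′ ++ ys′ → ys ≡ ys′
++-cancelˡ-length []       []         _       e = e
++-cancelˡ-length (_ ∷ xs) (_ ∷ xs′) ∣xs∣≡ e = ++-cancelˡ-length xs xs′ (suc-injective ∣xs∣≡) (∷-injectiveʳ e)

tryPark-length : ∀ d occ {occ′} → tryPark d occ ≡ just occ′ → length occ′ ≡ length occ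
tryPark-length zero    (false ∷ bs) refl = refl
tryPark-length zero    (true  ∷ bs) eq with tryPark zero bs in e
tryPark-length zero    (true  ∷ bs) refl | just _ = cong suc (tryPark-length zero bs e)
tryPark-length (suc d) (b ∷ bs)     eq with tryPark d bs in e
tryPark-length (suc d) (b ∷ bs)     refl | just _ = cong suc (tryPark-length d bs e)

tryPark-occupied : ∀ d occ {occ′} → tryPark d occ ≡ just occ′ → occupied occ′ ≡ suc (occupied occ)
tryPark-occupied zero    (false ∷ bs) refl = refl
tryPark-occupied zero    (true  ∷ bs) eq with tryPark zero bs in e
tryPark-occupied zero    (true  ∷ bs) refl | just _ = cong suc (tryPark-occupied zero bs e)
tryPark-occupied (suc d) (true  ∷ bs) eq with tryPark d bs in e
tryPark-occupied (suc d) (true  ∷ bs) refl | just _ = cong suc (tryPark-occupied d bs e)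
tryPark-occupied (suc d) (false ∷ bs) eq with tryPark d bs in e
tryPark-occupied (suc d) (false ∷ bs) refl | just _ = tryPark-occupied d bs e

parkAll-length : ∀ occ as → length (parkAll occ as) ≡ length occ
parkAll-length occ []       = refl
parkAll-length occ (a ∷ as) with tryPark (a ∸ 1) occ in e
... | just occ′ = trans (parkAll-length occ′ as) (tryPark-length (a ∸ 1) occ e)
... | nothing   = parkAll-length occ as

cars-conserved : ∀ occ as → occupied (parkAll occ as) + flawsFrom occ as ≡ occupied occ + length as
cars-conserved occ []       = refl
cars-conserved occ (a ∷ as) with tryPark (a ∸ 1) occ in e
... | just occ′ = trans (cars-conserved occ′ as) (trans (cong (_+ length as) (tryPark-occupied (a ∸ 1) occ e)) (sym (+-suc _ _)))
... | nothing   = trans (+-suc _ _) (trans (cong suc (cars-conserved occ as)) (sym (+-suc _ _)))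

parkAll-fills : ∀ M k h → flaws M h ≡ k → length h ≡ M + k → parkAll (replicate M false) h ≡ replicate M true
parkAll-fills M k h flaws≡k ∣h∣ =
  trans (occupied≡length⇒full final (trans all-occupied (sym ∣final∣))) (cong (λ z → replicate z true) ∣final∣)
  where
  final = parkAll (replicate M false) h
  ∣final∣ : length final ≡ M
  ∣final∣ = trans (parkAll-length (replicate M false) h) (length-replicate M)
  all-occupied : occupied final ≡ M
  all-occupied = +-cancelʳ-≡ k (occupied final) M
    (trans (cong (occupied final +_) (sym flaws≡k)) (trans (cars-conserved (replicate M false) h) (cong₂ _+_ (occupied-empty M) ∣h∣)))

occupied-parkAll< : ∀ n as → length as ≡ n → 1 ≤ flaws n as → occupied (parkAll (replicate n false) as) < n
occupied-parkAll< n as ∣as∣ 1≤flaws = begin-strict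
  occupied final                  <⟨ m<m+n (occupied final) 1≤flaws ⟩
  occupied final + flaws n as     ≡⟨ cars-conserved (replicate n false) as ⟩
  occupied (replicate n false) + length as ≡⟨ cong₂ _+_ (occupied-empty n) ∣as∣ ⟩
  n                               ∎
  where
  open ≤-Reasoning
  final = parkAll (replicate n false) as

tryPark-++ : ∀ d lo hi {lo′} → tryPark d lo ≡ just lo′ → tryPark d (lo ++ hi) ≡ just (lo′ ++ hi)
tryPark-++ zero    (false ∷ bs) hi refl = refl
tryPark-++ zero    (true  ∷ bs) hi eq with tryPark zero bs in e
tryPark-++ zero    (true  ∷ bs) hi refl | just _ rewrite tryPark-++ zero bs hi e = refl
tryPark-++ (suc d) (b ∷ bs)     hi eq with tryPark d bs in e
tryPark-++ (suc d) (b ∷ bs)     hi refl | just _ rewrite tryPark-++ d bs hi e = refl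

tryPark-++-overflow : ∀ d lo hi {r} → tryPark d lo ≡ nothing → d ≤ length lo → tryPark zero hi ≡ r →
  tryPark d (lo ++ hi) ≡ Maybe.map (lo ++_) r
tryPark-++-overflow zero [] hi _ _ refl = sym (Maybeₚ.map-id (tryPark zero hi))
tryPark-++-overflow zero (true ∷ bs) hi _ _ refl with tryPark zero bs in e
... | nothing = trans (cong (Maybe.map (true ∷_)) (tryPark-++-overflow zero bs hi e z≤n refl)) (sym (Maybeₚ.map-∘ (tryPark zero hi)))
tryPark-++-overflow (suc d) (b ∷ bs) hi _ (s≤s d≤) refl with tryPark d bs in e
... | nothing = trans (cong (Maybe.map (b ∷_)) (tryPark-++-overflow d bs hi e d≤ refl)) (sym (Maybeₚ.map-∘ (tryPark zero hi)))

tryPark-outside : ∀ d occ → length occ ≤ d → tryPark d occ ≡ nothing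
tryPark-outside zero    []       _       = refl
tryPark-outside (suc d) []       _       = refl
tryPark-outside (suc d) (b ∷ bs) (s≤s ≤d) rewrite tryPark-outside d bs ≤d = refl

tryPark-past : ∀ lo b hi y {r} → tryPark y hi ≡ r → tryPark (length lo + suc y) (lo ++ b ∷ hi) ≡ Maybe.map (λ r → lo ++ b ∷ r) r
tryPark-past []       b hi y refl = refl
tryPark-past (c ∷ lo) b hi y refl = trans (cong (Maybe.map (c ∷_)) (tryPark-past lo b hi y refl)) (sym (Maybeₚ.map-∘ (tryPark y hi)))

isOccupied : ℕ → List Bool → Bool
isOccupied d       []       = false
isOccupied zero    (b ∷ bs) = b
isOccupied (suc d) (b ∷ bs) = isOccupied d bs

isOccupied-++-∷ : ∀ lo b hi → isOccupied (length lo) (lo ++ b ∷ hi) ≡ b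
isOccupied-++-∷ []       b hi = refl
isOccupied-++-∷ (c ∷ lo) b hi = isOccupied-++-∷ lo b hi

tryPark-stays-occupied : ∀ d e occ {occ′} → isOccupied d occ ≡ true → tryPark e occ ≡ just occ′ → isOccupied d occ′ ≡ true
tryPark-stays-occupied zero    zero    (true  ∷ bs) _ eq with tryPark zero bs
tryPark-stays-occupied zero    zero    (true  ∷ bs) _ refl | just _ = refl
tryPark-stays-occupied (suc d) zero    (false ∷ bs) o refl = o
tryPark-stays-occupied (suc d) zero    (true  ∷ bs) o eq with tryPark zero bs in e
tryPark-stays-occupied (suc d) zero    (true  ∷ bs) o refl | just _ = tryPark-stays-occupied d zero bs o e
tryPark-stays-occupied zero    (suc e) (b ∷ bs)     o eq with tryPark e bs
tryPark-stays-occupied zero    (suc e) (b ∷ bs)     o refl | just _ = o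
tryPark-stays-occupied (suc d) (suc e) (b ∷ bs)     o eq with tryPark e bs in e′
tryPark-stays-occupied (suc d) (suc e) (b ∷ bs)     o refl | just _ = tryPark-stays-occupied d e bs o e′

parkAll-stays-occupied : ∀ d occ as → isOccupied d occ ≡ true → isOccupied d (parkAll occ as) ≡ true
parkAll-stays-occupied d occ []       o = o
parkAll-stays-occupied d occ (a ∷ as) o with tryPark (a ∸ 1) occ in e
... | just occ′ = parkAll-stays-occupied d occ′ as (tryPark-stays-occupied d (a ∸ 1) occ o e)
... | nothing   = parkAll-stays-occupied d occ as o

tryPark-into-gap : ∀ d lo hi → tryPark d lo ≡ nothing → d ≤ length lo → tryPark d (lo ++ false ∷ hi) ≡ just (lo ++ true ∷ hi)
tryPark-into-gap d lo hi fails d≤ = tryPark-++-overflow d lo (false ∷ hi) fails d≤ refl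

-- A car failing inside occ enters rest at its first space, exactly like a car preferring 1.
flawsFrom-++-overflow : ∀ occ rest c → All (_≤ length occ) c →
  flawsFrom (occ ++ rest) c ≡ flawsFrom rest (replicate (flawsFrom occ c) 1)
flawsFrom-++-overflow occ rest []      []          = refl
flawsFrom-++-overflow occ rest (x ∷ c) (x≤ ∷ c≤) with tryPark (x ∸ 1) occ in parks
... | just occ′ = trans (flawsFrom-park {a = x} c (tryPark-++ (x ∸ 1) occ rest parks))
                        (flawsFrom-++-overflow occ′ rest c (subst (λ m → All (_≤ m) c) (sym (tryPark-length (x ∸ 1) occ parks)) c≤))
... | nothing with tryPark 0 rest in parksRest
...   | just rest′ = trans (flawsFrom-park {a = x} c (tryPark-++-overflow (x ∸ 1) occ rest parks (≤-trans (m∸n≤m x 1) x≤) parksRest))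
                           (flawsFrom-++-overflow occ rest′ c c≤)
...   | nothing    = trans (flawsFrom-fail {a = x} c (tryPark-++-overflow (x ∸ 1) occ rest parks (≤-trans (m∸n≤m x 1) x≤) parksRest))
                           (cong suc (flawsFrom-++-overflow occ rest c c≤))

flawsFrom-ones : ∀ i k j → flawsFrom (replicate i true ++ replicate k false) (replicate j 1) ≡ j ∸ k
flawsFrom-ones i k       zero    = sym (0∸n≡0 k)
flawsFrom-ones i zero    (suc j) = trans (flawsFrom-fail {a = 1} (replicate j 1) (full i)) (cong suc (flawsFrom-ones i zero j))
  where
  full : ∀ i → tryPark 0 (replicate i true ++ []) ≡ nothing
  full zero    = refl
  full (suc i) rewrite full i = refl
flawsFrom-ones i (suc k) (suc j) =
  trans (flawsFrom-park {a = 1} {occ = replicate i true ++ replicate (suc k) false} (replicate j 1) (firstFree i)) (flawsFrom-ones (suc i) k j)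
  where
  firstFree : ∀ i → tryPark 0 (replicate i true ++ false ∷ replicate k false) ≡ just (replicate (suc i) true ++ replicate k false)
  firstFree zero    = refl
  firstFree (suc i) rewrite firstFree i = refl

flaws-extra-spaces : ∀ M k c → All (_≤ M) c → flaws (M + k) c ≡ flaws M c ∸ k
flaws-extra-spaces M k c c≤ =
  trans (cong (λ occ → flawsFrom occ c) (replicate-+ M k false))
  (trans (flawsFrom-++-overflow (replicate M false) (replicate k false) c (subst (λ m → All (_≤ m) c) (sym (length-replicate M)) c≤))
         (flawsFrom-ones 0 k (flaws M c)))

excess≤flaws : ∀ M k c → length c ≡ M + k → k ≤ flaws M c
excess≤flaws M k c ∣c∣ = +-cancelˡ-≤ M k _ (begin
  M + k                                        ≡⟨ cong₂ _+_ (occupied-empty M) ∣c∣ ⟨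
  occupied (replicate M false) + length c      ≡⟨ cars-conserved (replicate M false) c ⟨
  occupied (parkAll (replicate M false) c) + flaws M c
    ≤⟨ +-monoˡ-≤ _ (≤-trans (occupied≤length (parkAll (replicate M false) c)) (≤-reflexive (trans (parkAll-length _ c) (length-replicate M)))) ⟩
  M + flaws M c                                ∎)
  where open ≤-Reasoning

-- flaws (M + k) c = flaws M c ∸ k, while counting cars gives flaws M c ≥ k.
k-flaws⇔parking-function : ∀ M k c → All (_≤ M) c → length c ≡ M + k → 𝟙 (flaws M c ≟ k) ≡ 𝟙 (flaws (M + k) c ≟ 0)
k-flaws⇔parking-function M k c c≤ ∣c∣ = 𝟙-cong (flaws M c ≟ k) (flaws (M + k) c ≟ 0)
  (λ flaws≡k → trans extra (trans (cong (_∸ k) flaws≡k) (n∸n≡0 k)))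
  (λ flaws≡0 → ≤-antisym (m∸n≡0⇒m≤n (trans (sym extra) flaws≡0)) (excess≤flaws M k c ∣c∣))
  where
  extra = flaws-extra-spaces M k c c≤

-- Splitting a preference sequence at an empty space

data Side (d : ℕ) : ℕ → Set where
  left  : ∀ {x} → x ≤ d → Side d x
  gap   : Side d (suc d)
  right : ∀ y → Side d (suc d + suc y)

side : ∀ d x → Side d x
side d       zero          = left z≤n
side zero    (suc zero)    = gap
side zero    (suc (suc y)) = right y
side (suc d) (suc x) with side d x
... | left x≤d = left (s≤s x≤d)
... | gap      = gap
... | right y  = right y

side-≤ : ∀ {d x} (x≤d : x ≤ d) → side d x ≡ left x≤d
side-≤ {d}     z≤n       = refl
side-≤ {suc d} (s≤s x≤d) rewrite side-≤ x≤d = refl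

side-gap : ∀ d → side d (suc d) ≡ gap
side-gap zero    = refl
side-gap (suc d) rewrite side-gap d = refl

side-right : ∀ d y → side d (suc d + suc y) ≡ right y
side-right zero    y = refl
side-right (suc d) y rewrite side-right d y = refl

Halves : Set
Halves = List ℕ × List ℕ

route : ∀ {d x} → Side d x → Maybe Halves → Maybe Halves
route {x = x} (left _) = Maybe.map (map₁ (x ∷_))
route gap              = λ _ → nothing
route (right y)        = Maybe.map (map₂ (suc y ∷_))

-- splitAtGap d a: the cars preferring 1..d, and the cars preferring d+2.. with preferences shifted down by d+1;
-- nothing if some car prefers d+1.
splitAtGap : ℕ → List ℕ → Maybe Halves
splitAtGap d []      = just ([] , [])
splitAtGap d (x ∷ a) = route (side d x) (splitAtGap d a)

splitAtGap-length : ∀ d b {l h} → splitAtGap d b ≡ just (l , h) → length l + length h ≡ length b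
splitAtGap-length d []      refl = refl
splitAtGap-length d (x ∷ b) eq with side d x | splitAtGap d b in split≡
splitAtGap-length d (x ∷ b) refl | left _  | just (l , h) = cong suc (splitAtGap-length d b split≡)
splitAtGap-length d (_ ∷ b) refl | right _ | just (l , h) = trans (+-suc (length l) (length h)) (cong suc (splitAtGap-length d b split≡))

splitAtGap-right-bound : ∀ d s b {l y h} → splitAtGap d b ≡ just (l , y ∷ h) → All (_≤ s) b → 2 + d ≤ s
splitAtGap-right-bound d s (x ∷ b) eq (x≤s ∷ b≤s) with side d x | splitAtGap d b in split≡
splitAtGap-right-bound d s (x ∷ b) refl (x≤s ∷ b≤s) | left _  | just _ = splitAtGap-right-bound d s b split≡ b≤s
splitAtGap-right-bound d s (_ ∷ b) refl (x≤s ∷ b≤s) | right y | just _ =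
  ≤-trans (s≤s (subst (suc d ≤_) (sym (+-suc d y)) (s≤s (m≤m+n d y)))) x≤s

splitAtGap-first : ∀ d b {l′ h} → splitAtGap d (1 ∷ b) ≡ just (l′ , h) → ∃ λ l → l′ ≡ 1 ∷ l × splitAtGap d b ≡ just (l , h)
splitAtGap-first zero    b ()
splitAtGap-first (suc d) b eq with splitAtGap (suc d) b
splitAtGap-first (suc d) b refl | just (l , h) = l , refl , refl

parking-splits-at-gap : ∀ a lo hi {l h} → splitAtGap (length lo) a ≡ just (l , h) → flawsFrom lo l ≡ 0 →
  flawsFrom (lo ++ false ∷ hi) a ≡ flawsFrom hi h × parkAll (lo ++ false ∷ hi) a ≡ parkAll lo l ++ false ∷ parkAll hi h
parking-splits-at-gap []      lo hi refl _ = refl , refl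
parking-splits-at-gap (x ∷ a) lo hi eq noFlaw with side (length lo) x | splitAtGap (length lo) a in split≡
parking-splits-at-gap (x ∷ a) lo hi refl noFlaw | left _ | just (l , h) with tryPark (x ∸ 1) lo in parks
... | just lo′ =
  let split≡′ = subst (λ d → splitAtGap d a ≡ just (l , h)) (sym (tryPark-length (x ∸ 1) lo parks)) split≡
      flaws≡ , parkAll≡ = parking-splits-at-gap a lo′ hi split≡′ noFlaw
      parks′ = tryPark-++ (x ∸ 1) lo (false ∷ hi) parks
  in trans (flawsFrom-park {a = x} a parks′) flaws≡ , trans (parkAll-park {a = x} a parks′) parkAll≡
parking-splits-at-gap (_ ∷ a) lo hi refl noFlaw | right y | just (l , h) with tryPark y hi in parks
... | just hi′ =
  let flaws≡ , parkAll≡ = parking-splits-at-gap a lo hi′ split≡ noFlaw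
      x = suc (length lo) + suc y
      parks′ = tryPark-past lo false hi y parks
  in trans (flawsFrom-park {a = x} a parks′) flaws≡ ,
     trans (parkAll-park {a = x} a parks′) parkAll≡
... | nothing =
  let flaws≡ , parkAll≡ = parking-splits-at-gap a lo hi split≡ noFlaw
      x = suc (length lo) + suc y
      fails′ = tryPark-past lo false hi y parks
  in trans (flawsFrom-fail {a = x} a fails′) (cong suc flaws≡) ,
     trans (parkAll-fail {a = x} a fails′) parkAll≡

SplitsCleanly : List ℕ → List Bool → Set
SplitsCleanly a lo = ∃₂ λ l h → splitAtGap (length lo) a ≡ just (l , h) × flawsFrom lo l ≡ 0

gap-filled-or-splits : ∀ a lo hi → isOccupied (length lo) (parkAll (lo ++ false ∷ hi) a) ≡ true ⊎ SplitsCleanly a lo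
gap-filled-or-splits []      lo hi = inj₂ ([] , [] , refl , refl)
gap-filled-or-splits (x ∷ a) lo hi with side (length lo) x
... | gap =
  let parks = tryPark-into-gap (length lo) lo hi (tryPark-outside (length lo) lo ≤-refl) ≤-refl
  in inj₁ (trans (cong (isOccupied (length lo)) (parkAll-park {a = x} a parks))
                 (parkAll-stays-occupied (length lo) _ a (isOccupied-++-∷ lo true hi)))
... | left x≤ with tryPark (x ∸ 1) lo in parks
...   | nothing =
  let parks′ = tryPark-into-gap (x ∸ 1) lo hi parks (≤-trans (m∸n≤m x 1) x≤)
  in inj₁ (trans (cong (isOccupied (length lo)) (parkAll-park {a = x} a parks′))
                 (parkAll-stays-occupied (length lo) _ a (isOccupied-++-∷ lo true hi)))
...   | just lo′ with gap-filled-or-splits a lo′ hi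
...     | inj₁ filled = inj₁ (trans (cong (isOccupied (length lo)) (parkAll-park {a = x} a (tryPark-++ (x ∸ 1) lo (false ∷ hi) parks)))
                                    (subst (λ d → isOccupied d (parkAll (lo′ ++ false ∷ hi) a) ≡ true) (tryPark-length (x ∸ 1) lo parks) filled))
...     | inj₂ (l , h , split≡ , noFlaw) =
  inj₂ (x ∷ l , h , cong (route (left x≤)) (subst (λ d → splitAtGap d a ≡ just (l , h)) (tryPark-length (x ∸ 1) lo parks) split≡) ,
        trans (flawsFrom-park {a = x} l parks) noFlaw)
gap-filled-or-splits (x ∷ a) lo hi | right y with tryPark y hi in parks
... | just hi′ with gap-filled-or-splits a lo hi′
...   | inj₁ filled = inj₁ (trans (cong (isOccupied (length lo)) (parkAll-park {a = x} a (tryPark-past lo false hi y parks))) filled)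
...   | inj₂ (l , h , split≡ , noFlaw) = inj₂ (l , suc y ∷ h , cong (route {length lo} (right y)) split≡ , noFlaw)
gap-filled-or-splits (x ∷ a) lo hi | right y | nothing with gap-filled-or-splits a lo hi
...   | inj₁ filled = inj₁ (trans (cong (isOccupied (length lo)) (parkAll-fail {a = x} a (tryPark-past lo false hi y parks))) filled)
...   | inj₂ (l , h , split≡ , noFlaw) = inj₂ (l , suc y ∷ h , cong (route {length lo} (right y)) split≡ , noFlaw)

-- The shuffle identity

weigh : ℕ → (List ℕ → ℕ) → (List ℕ → ℕ) → Maybe Halves → ℕ
weigh j F G nothing        = 0
weigh j F G (just (l , h)) = 𝟙 (length l ≟ j) * F l * G h

splitWeight : ℕ → ℕ → (List ℕ → ℕ) → (List ℕ → ℕ) → List ℕ → ℕ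
splitWeight d j F G b = weigh j F G (splitAtGap d b)

weigh≢0 : ∀ j F G m → weigh j F G m ≢ 0 → ∃₂ λ l h → m ≡ just (l , h) × 𝟙 (length l ≟ j) ≢ 0 × F l ≢ 0 × G h ≢ 0
weigh≢0 j F G nothing        ≢0 = ⊥-elim (≢0 refl)
weigh≢0 j F G (just (l , h)) ≢0 = l , h , refl ,
  (λ e → ≢0 (cong (λ z → z * F l * G h) e)) ,
  (λ e → ≢0 (trans (cong (λ z → 𝟙 (length l ≟ j) * z * G h) e) (cong (_* G h) (*-zeroʳ (𝟙 (length l ≟ j)))))) ,
  (λ e → ≢0 (trans (cong (𝟙 (length l ≟ j) * F l *_) e) (*-zeroʳ (𝟙 (length l ≟ j) * F l))))

splitWeight-left : ∀ d j F G x b → x ≤ d → splitWeight d (suc j) F G (x ∷ b) ≡ splitWeight d j (λ l → F (x ∷ l)) G b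
splitWeight-left d j F G x b x≤d rewrite side-≤ x≤d with splitAtGap d b
... | nothing = refl
... | just _  = refl

splitWeight-left-zero : ∀ d F G x b → x ≤ d → splitWeight d 0 F G (x ∷ b) ≡ 0
splitWeight-left-zero d F G x b x≤d rewrite side-≤ x≤d with splitAtGap d b
... | nothing = refl
... | just _  = refl

splitWeight-gap : ∀ d j F G b → splitWeight d j F G (suc d ∷ b) ≡ 0
splitWeight-gap d j F G b rewrite side-gap d = refl

splitWeight-right : ∀ d j F G y b → splitWeight d j F G (suc d + suc y ∷ b) ≡ splitWeight d j F (λ h → G (suc y ∷ h)) b
splitWeight-right d j F G y b rewrite side-right d y with splitAtGap d b
... | nothing = refl
... | just _  = refl

∑-range-gap : ∀ d r g → ∑ (range 0 (d + suc r)) g ≡ ∑ (range 0 d) g + (g (suc d) + ∑ (range 0 r) (λ y → g (suc d + y)))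
∑-range-gap d r g = trans (cong (λ L → ∑ L g) (range-++ 0 d (suc r)))
  (trans (∑-++ (range 0 d) (range d (suc r)) g) (cong (λ z → ∑ (range 0 d) g + (g (suc d) + z)) (∑-range-shift (suc d) r g)))

∑seq-splitWeight-first : ∀ N d r j F G → let V = range 0 (d + suc r) in
  ∑seq (suc N) V (splitWeight d j F G) ≡
    ∑ (range 0 d) (λ x → ∑seq N V (λ b → splitWeight d j F G (x ∷ b))) + ∑ (range 0 r) (λ y → ∑seq N V (splitWeight d j F (λ h → G (y ∷ h))))
∑seq-splitWeight-first N d r j F G =
  trans (∑-range-gap d r _) (cong (∑ (range 0 d) (λ x → ∑seq N V (λ b → splitWeight d j F G (x ∷ b))) +_) (cong₂ _+_ gap-zero right-part))
  where
  V = range 0 (d + suc r)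
  gap-zero : ∑seq N V (λ b → splitWeight d j F G (suc d ∷ b)) ≡ 0
  gap-zero = trans (∑seq-cong N V (splitWeight-gap d j F G)) (∑seq-zero N V)
  right-part : ∑ (range 0 r) (λ y → ∑seq N V (λ b → splitWeight d j F G (suc d + y ∷ b))) ≡
               ∑ (range 0 r) (λ y → ∑seq N V (splitWeight d j F (λ h → G (y ∷ h))))
  right-part = ∑-cong-range 0 r λ { zero () _ ; (suc y) _ _ → ∑seq-cong N V (splitWeight-right d j F G y) }

-- Choosing which j of the N positions carry the left part gives the binomial coefficient.
∑seq-splitWeight : ∀ N d r j F G →
  ∑seq N (range 0 (d + suc r)) (splitWeight d j F G) ≡ (N C j) * ∑seq j (range 0 d) F * ∑seq (N ∸ j) (range 0 r) G
∑seq-splitWeight zero    d r zero    F G = refl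
∑seq-splitWeight zero    d r (suc j) F G = refl
∑seq-splitWeight (suc N) d r zero    F G = begin
    ∑seq (suc N) V (splitWeight d 0 F G)
  ≡⟨ ∑seq-splitWeight-first N d r 0 F G ⟩
    ∑ (range 0 d) (λ x → ∑seq N V (λ b → splitWeight d 0 F G (x ∷ b))) + ∑ (range 0 r) (λ y → ∑seq N V (splitWeight d 0 F (λ h → G (y ∷ h))))
  ≡⟨ cong₂ _+_ left-zero (∑-cong (range 0 r) (λ y → ∑seq-splitWeight N d r 0 F (λ h → G (y ∷ h)))) ⟩
    ∑ (range 0 r) (λ y → (N C 0) * F [] * ∑seq N (range 0 r) (λ h → G (y ∷ h)))
  ≡⟨ ∑-*ˡ (range 0 r) ((N C 0) * F []) (λ y → ∑seq N (range 0 r) (λ h → G (y ∷ h))) ⟩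
    (N C 0) * F [] * ∑seq (suc N) (range 0 r) G
  ∎
  where
  open ≡-Reasoning
  V = range 0 (d + suc r)
  left-zero : ∑ (range 0 d) (λ x → ∑seq N V (λ b → splitWeight d 0 F G (x ∷ b))) ≡ 0
  left-zero = trans (∑-cong-range 0 d (λ x _ x≤d → trans (∑seq-cong N V (λ b → splitWeight-left-zero d F G x b x≤d)) (∑seq-zero N V)))
                    (∑-zero (range 0 d))
∑seq-splitWeight (suc N) d r (suc j) F G = begin
    ∑seq (suc N) V (splitWeight d (suc j) F G)
  ≡⟨ ∑seq-splitWeight-first N d r (suc j) F G ⟩
    ∑ (range 0 d) (λ x → ∑seq N V (λ b → splitWeight d (suc j) F G (x ∷ b))) + ∑ (range 0 r) (λ y → ∑seq N V (splitWeight d (suc j) F (λ h → G (y ∷ h))))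
  ≡⟨ cong₂ _+_ (∑-cong-range 0 d (λ x _ x≤d → trans (∑seq-cong N V (λ b → splitWeight-left d j F G x b x≤d))
                                                     (∑seq-splitWeight N d r j (λ l → F (x ∷ l)) G)))
               (∑-cong (range 0 r) (λ y → ∑seq-splitWeight N d r (suc j) F (λ h → G (y ∷ h)))) ⟩
    ∑ (range 0 d) (λ x → (N C j) * ∑seq j (range 0 d) (λ l → F (x ∷ l)) * Gs)
      + ∑ (range 0 r) (λ y → (N C suc j) * Fs * ∑seq (N ∸ suc j) (range 0 r) (λ h → G (y ∷ h)))
  ≡⟨ cong₂ _+_ (trans (∑-*ʳ (range 0 d) Gs (λ x → (N C j) * ∑seq j (range 0 d) (λ l → F (x ∷ l)))) (cong (_* Gs) (∑-*ˡ (range 0 d) (N C j) _)))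
               (∑-*ˡ (range 0 r) ((N C suc j) * Fs) (λ y → ∑seq (N ∸ suc j) (range 0 r) (λ h → G (y ∷ h)))) ⟩
    (N C j) * Fs * Gs + (N C suc j) * Fs * ∑seq (suc (N ∸ suc j)) (range 0 r) G
  ≡⟨ cong ((N C j) * Fs * Gs +_) right-count ⟩
    (N C j) * Fs * Gs + (N C suc j) * Fs * Gs
  ≡⟨ +-factor (N C j) (N C suc j) Fs Gs ⟩
    ((N C j) + (N C suc j)) * Fs * Gs
  ≡⟨ cong (λ c → c * Fs * Gs) (nCk+nC[k+1]≡[n+1]C[k+1] N j) ⟩
    (suc N C suc j) * Fs * Gs
  ∎
  where
  open ≡-Reasoning
  V  = range 0 (d + suc r)
  Fs = ∑seq (suc j) (range 0 d) F
  Gs = ∑seq (N ∸ j) (range 0 r) G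
  +-factor : ∀ a b f g → a * f * g + b * f * g ≡ (a + b) * f * g
  +-factor = solve-∀
  -- When suc j > N the coefficient vanishes, so the mismatch suc (N ∸ suc j) ≠ N ∸ j is harmless.
  right-count : (N C suc j) * Fs * ∑seq (suc (N ∸ suc j)) (range 0 r) G ≡ (N C suc j) * Fs * Gs
  right-count with suc j ≤? N
  ... | yes j<N = cong (λ z → (N C suc j) * Fs * ∑seq z (range 0 r) G) (sym (+-∸-assoc 1 j<N))
  ... | no  j≮N rewrite k>n⇒nCk≡0 {N} {suc j} (≰⇒> j≮N) = refl

-- Counting preference sets as sums over sequences

applyUpTo-range : ∀ N a → applyUpTo (λ x → suc (a + x)) N ≡ range a N
applyUpTo-range zero    a = refl
applyUpTo-range (suc N) a = cong₂ _∷_ (cong suc (+-identityʳ a))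
  (trans (applyUpTo-cong N (λ x → cong suc (+-suc a x))) (applyUpTo-range N (suc a)))
  where
  applyUpTo-cong : ∀ N {f g : ℕ → ℕ} → (∀ x → f x ≡ g x) → applyUpTo f N ≡ applyUpTo g N
  applyUpTo-cong zero    f≗g = refl
  applyUpTo-cong (suc N) f≗g = cong₂ _∷_ (f≗g 0) (applyUpTo-cong N (λ x → f≗g (suc x)))

filter-≤-range-below : ∀ m a b → a + b ≤ m → filter (_≤? m) (range a b) ≡ range a b
filter-≤-range-below m a zero    _   = refl
filter-≤-range-below m a (suc b) a+b≤m =
  trans (filter-accept (_≤? m) (≤-trans (subst (suc a ≤_) (sym (+-suc a b)) (s≤s (m≤m+n a b))) a+b≤m))
        (cong (suc a ∷_) (filter-≤-range-below m (suc a) b (subst (_≤ m) (+-suc a b) a+b≤m)))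

filter-≤-range-above : ∀ m a b → m ≤ a → filter (_≤? m) (range a b) ≡ []
filter-≤-range-above m a zero    _   = refl
filter-≤-range-above m a (suc b) m≤a =
  trans (filter-reject (_≤? m) (λ a<m → <-irrefl refl (≤-trans a<m m≤a))) (filter-≤-range-above m (suc a) b (m≤n⇒m≤1+n m≤a))

values≡range : ∀ M s → s ≤ M → values M s ≡ range 0 s
values≡range M s s≤M = begin
  filter (_≤? s) (applyUpTo suc M)                          ≡⟨ cong (filter (_≤? s)) (applyUpTo-range M 0) ⟩
  filter (_≤? s) (range 0 M)                                ≡⟨ cong (λ z → filter (_≤? s) (range 0 z)) (m+[n∸m]≡n s≤M) ⟨
  filter (_≤? s) (range 0 (s + (M ∸ s)))                    ≡⟨ cong (filter (_≤? s)) (range-++ 0 s (M ∸ s)) ⟩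
  filter (_≤? s) (range 0 s ++ range s (M ∸ s))             ≡⟨ filter-++ (_≤? s) (range 0 s) (range s (M ∸ s)) ⟩
  filter (_≤? s) (range 0 s) ++ filter (_≤? s) (range s (M ∸ s))
    ≡⟨ cong₂ _++_ (filter-≤-range-below s 0 s ≤-refl) (filter-≤-range-above s s (M ∸ s) ≤-refl) ⟩
  range 0 s ++ []                                           ≡⟨ ++-identityʳ (range 0 s) ⟩
  range 0 s                                                 ∎
  where open ≡-Reasoning

Σ₁≡∑-range : ∀ U f → Σ₁ U f ≡ ∑ (range 0 U) f
Σ₁≡∑-range U f = cong (λ L → sum (map f L)) (applyUpTo-range U 0)

p≡∑seq : ∀ N M s κ → s ≤ M → p N M s κ ≡ ∑seq N (range 0 s) (λ c → 𝟙 (flaws M c ≟ κ))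
p≡∑seq N M s κ s≤M = trans (length-filter-𝟙 (λ as → flaws M as ≟ κ) (prefSets N M s))
  (trans (sum-map-seqs N (values M s) _) (cong (λ V → ∑seq N V (λ c → 𝟙 (flaws M c ≟ κ))) (values≡range M s s≤M)))

pˡ1≡∑seq : ∀ N M s κ → s ≤ M → 1 ≤ s → pˡ 1 (suc N) M s κ ≡ ∑seq N (range 0 s) (λ b → 𝟙 (flaws M (1 ∷ b) ≟ κ))
pˡ1≡∑seq N M (suc s) κ s≤M _ = begin
    pˡ 1 (suc N) M (suc s) κ
  ≡⟨ length-filter²-𝟙 (firstIs? 1) (λ as → flaws M as ≟ κ) (prefSets (suc N) M (suc s)) ⟩
    sum (map (λ a → 𝟙 (firstIs? 1 a) * 𝟙 (flaws M a ≟ κ)) (prefSets (suc N) M (suc s)))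
  ≡⟨ sum-map-seqs (suc N) (values M (suc s)) _ ⟩
    ∑seq (suc N) (values M (suc s)) (λ a → 𝟙 (firstIs? 1 a) * 𝟙 (flaws M a ≟ κ))
  ≡⟨ cong (λ V → ∑seq (suc N) V (λ a → 𝟙 (firstIs? 1 a) * 𝟙 (flaws M a ≟ κ))) (values≡range M (suc s) s≤M) ⟩
    ∑ (range 0 (suc s)) (λ x → ∑seq N V (λ b → 𝟙 (x ≟ 1) * 𝟙 (flaws M (x ∷ b) ≟ κ)))
  ≡⟨ ∑-cong (range 0 (suc s)) (λ x → ∑seq-*ˡ N V (𝟙 (x ≟ 1)) (λ b → 𝟙 (flaws M (x ∷ b) ≟ κ))) ⟩
    ∑ (range 0 (suc s)) (λ x → 𝟙 (x ≟ 1) * ∑seq N V (λ b → 𝟙 (flaws M (x ∷ b) ≟ κ)))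
  ≡⟨ ∑-single 0 (suc s) _ 1 (s≤s z≤n) (s≤s z≤n) (λ x _ _ x≢1 → cong (_* ∑seq N V (λ b → 𝟙 (flaws M (x ∷ b) ≟ κ))) (𝟙-no (x ≟ 1) x≢1)) ⟩
    1 * ∑seq N V (λ b → 𝟙 (flaws M (1 ∷ b) ≟ κ))
  ≡⟨ *-identityˡ _ ⟩
    ∑seq N V (λ b → 𝟙 (flaws M (1 ∷ b) ≟ κ))
  ∎
  where
  open ≡-Reasoning
  V = range 0 (suc s)

-- The summand for a fixed empty space

gapWeight : ℕ → ℕ → ℕ → ℕ → List ℕ → ℕ
gapWeight d j M k = splitWeight d j (λ l → 𝟙 (flaws d (1 ∷ l) ≟ 0)) (λ h → 𝟙 (flaws M h ≟ k))

m+n+o≡m+[o+n] : ∀ m n o → m + n + o ≡ m + (o + n)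
m+n+o≡m+[o+n] = solve-∀

gapWeight-sound : ∀ d j M k b → 1 ≤ d → j + k ≡ d → length b ≡ d + M → gapWeight d j M k b ≢ 0 →
  flaws (d + suc M) (1 ∷ b) ≡ k × ∃ λ x → length x ≡ d × parkAll (replicate (d + suc M) false) (1 ∷ b) ≡ x ++ false ∷ replicate M true
gapWeight-sound d j M k b 1≤d j+k≡d ∣b∣ ≢0 with weigh≢0 j _ _ (splitAtGap d b) ≢0
... | l , h , split≡ , ∣l∣≢0 , noFlaw≢0 , kFlaws≢0 = trans (cong (λ o → flawsFrom o (1 ∷ b)) spaces) (trans flaws≡ flaws-h) , parkAll lo (1 ∷ l) , ∣x∣ , final≡
  where
  lo = replicate d false
  hi = replicate M false
  noFlaw = 𝟙≢0⇒ (flaws d (1 ∷ l) ≟ 0) noFlaw≢0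
  flaws-h = 𝟙≢0⇒ (flaws M h ≟ k) kFlaws≢0
  split₁ : splitAtGap (length lo) (1 ∷ b) ≡ just (1 ∷ l , h)
  split₁ = subst (λ e → splitAtGap e (1 ∷ b) ≡ just (1 ∷ l , h)) (sym (length-replicate d))
    (trans (cong (λ σ → route σ (splitAtGap d b)) (side-≤ 1≤d)) (cong (Maybe.map (map₁ (1 ∷_))) split≡))
  spaces : replicate (d + suc M) false ≡ lo ++ false ∷ hi
  spaces = replicate-+ d (suc M) false
  flaws≡  = proj₁ (parking-splits-at-gap (1 ∷ b) lo hi split₁ noFlaw)
  parkAll≡ = proj₂ (parking-splits-at-gap (1 ∷ b) lo hi split₁ noFlaw)
  ∣h∣ : length h ≡ M + k
  ∣h∣ = +-cancelˡ-≡ j (length h) (M + k) (begin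
    j + length h         ≡⟨ cong (_+ length h) (𝟙≢0⇒ (length l ≟ j) ∣l∣≢0) ⟨
    length l + length h  ≡⟨ trans (splitAtGap-length d b split≡) ∣b∣ ⟩
    d + M                ≡⟨ cong (_+ M) j+k≡d ⟨
    j + k + M            ≡⟨ m+n+o≡m+[o+n] j k M ⟩
    j + (M + k)          ∎)
    where open ≡-Reasoning
  ∣x∣ = trans (parkAll-length lo (1 ∷ l)) (length-replicate d)
  final≡ = trans (cong (λ o → parkAll o (1 ∷ b)) spaces) (trans parkAll≡ (cong (λ z → parkAll lo (1 ∷ l) ++ false ∷ z) (parkAll-fills M k h flaws-h ∣h∣)))

SplitAtLastEmpty : ℕ → ℕ → List ℕ → Set
SplitAtLastEmpty n k b = ∃₂ λ d M → ∃₂ λ l h →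
  n ≡ d + suc M × splitAtGap d b ≡ just (l , h) × flaws d (1 ∷ l) ≡ 0 × flaws M h ≡ k × length h ≡ M + k

split-at-last-empty : ∀ n′ k b → 1 ≤ k → length b ≡ n′ → flaws (suc n′) (1 ∷ b) ≡ k → SplitAtLastEmpty (suc n′) k b
split-at-last-empty n′ k b 1≤k ∣b∣ flaws≡k =
  at (lastEmpty final (subst (occupied final <_) (sym ∣final∣) (occupied-parkAll< n (1 ∷ b) (cong suc ∣b∣) (subst (1 ≤_) (sym flaws≡k) 1≤k))))
  where
  n = suc n′
  final = parkAll (replicate n false) (1 ∷ b)
  ∣final∣ : length final ≡ n
  ∣final∣ = trans (parkAll-length (replicate n false) (1 ∷ b)) (length-replicate n)
  at : (∃₂ λ x M → final ≡ x ++ false ∷ replicate M true) → SplitAtLastEmpty n k b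
  at (x , M , final≡) = cut (gap-filled-or-splits (1 ∷ b) lo hi)
    where
    d  = length x
    lo = replicate d false
    hi = replicate M false
    ∣lo∣ : length lo ≡ d
    ∣lo∣ = length-replicate d
    n≡ : n ≡ d + suc M
    n≡ = trans (sym ∣final∣) (trans (cong length final≡) (trans (length-++ x) (cong (λ z → d + suc z) (length-replicate M))))
    spaces : replicate n false ≡ lo ++ false ∷ hi
    spaces = trans (cong (λ z → replicate z false) n≡) (replicate-+ d (suc M) false)
    cut : isOccupied (length lo) (parkAll (lo ++ false ∷ hi) (1 ∷ b)) ≡ true ⊎ SplitsCleanly (1 ∷ b) lo → SplitAtLastEmpty n k b
    cut (inj₁ filled) = ⊥-elim (true≢false (begin
      true                                          ≡⟨ filled ⟨
      isOccupied (length lo) (parkAll (lo ++ false ∷ hi) (1 ∷ b)) ≡⟨ cong₂ (λ e o → isOccupied e (parkAll o (1 ∷ b))) (sym ∣lo∣) spaces ⟨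
      isOccupied d final                           ≡⟨ cong (isOccupied d) final≡ ⟩
      isOccupied d (x ++ false ∷ replicate M true) ≡⟨ isOccupied-++-∷ x false (replicate M true) ⟩
      false                                        ∎))
      where
      open ≡-Reasoning
      true≢false : true ≢ false
      true≢false ()
    cut (inj₂ (l′ , h , split≡ , noFlaw)) with splitAtGap-first d b (subst (λ e → splitAtGap e (1 ∷ b) ≡ just (l′ , h)) ∣lo∣ split≡)
    ... | l , refl , split-b = d , M , l , h , n≡ , split-b , noFlaw , flaws-h , ∣h∣
      where
      flaws-h : flaws M h ≡ k
      flaws-h = trans (sym (trans (cong (λ o → flawsFrom o (1 ∷ b)) spaces) (proj₁ (parking-splits-at-gap (1 ∷ b) lo hi split≡ noFlaw)))) flaws≡k
      fills : parkAll hi h ≡ replicate M true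
      fills = sym (∷-injectiveʳ (++-cancelˡ-length x (parkAll lo (1 ∷ l))
        (sym (trans (parkAll-length lo (1 ∷ l)) ∣lo∣))
        (trans (sym final≡) (trans (cong (λ o → parkAll o (1 ∷ b)) spaces) (proj₂ (parking-splits-at-gap (1 ∷ b) lo hi split≡ noFlaw))))))
      ∣h∣ : length h ≡ M + k
      ∣h∣ = sym (begin
        M + k                                   ≡⟨ cong₂ _+_ (trans (sym (occupied-full M)) (cong occupied (sym fills))) (sym flaws-h) ⟩
        occupied (parkAll hi h) + flaws M h     ≡⟨ cars-conserved hi h ⟩
        occupied hi + length h                  ≡⟨ cong (_+ length h) (occupied-empty M) ⟩
        length h                                ∎)
        where open ≡-Reasoning

gapWeight-complete : ∀ n′ s k b → 1 ≤ k → All (_≤ s) b → length b ≡ n′ → flaws (suc n′) (1 ∷ b) ≡ k →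
  ∃₂ λ d M → ∃ λ j → suc n′ ≡ d + suc M × j + k ≡ d × 2 + d ≤ s × gapWeight d j M k b ≡ 1
gapWeight-complete n′ s k b 1≤k b≤s ∣b∣ flaws≡k with split-at-last-empty n′ k b 1≤k ∣b∣ flaws≡k
... | d , M , l , h , n≡ , split≡ , noFlaw , flaws-h , ∣h∣ = d , M , length l , n≡ , j+k≡d , bound h split≡ ∣h∣ , weight≡1
  where
  j+k≡d : length l + k ≡ d
  j+k≡d = +-cancelʳ-≡ M (length l + k) d (begin
    length l + k + M        ≡⟨ m+n+o≡m+[o+n] (length l) k M ⟩
    length l + (M + k)      ≡⟨ cong (length l +_) ∣h∣ ⟨
    length l + length h     ≡⟨ trans (splitAtGap-length d b split≡) ∣b∣ ⟩
    n′                      ≡⟨ suc-injective (trans n≡ (+-suc d M)) ⟩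
    d + M                   ∎)
    where
    open ≡-Reasoning
  bound : ∀ h′ → splitAtGap d b ≡ just (l , h′) → length h′ ≡ M + k → 2 + d ≤ s
  bound []       _      ∣h′∣ = ⊥-elim (n≮0 (subst (1 ≤_) (sym ∣h′∣) (≤-trans 1≤k (m≤n+m k M))))
  bound (_ ∷ h′) split≡′ _   = splitAtGap-right-bound d s b split≡′ b≤s
  weight≡1 : gapWeight d (length l) M k b ≡ 1
  weight≡1 = trans (cong (weigh (length l) _ _) split≡)
    (cong₂ _*_ (cong₂ _*_ (𝟙-yes (length l ≟ length l) refl) (𝟙-yes (flaws d (1 ∷ l) ≟ 0) noFlaw)) (𝟙-yes (flaws M h ≟ k) flaws-h))

∑seq-gapWeight : ∀ d j M k i → j + k ≡ d → i ≤ M → 1 ≤ d →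
  ∑seq (d + M) (range 0 (d + suc i)) (gapWeight d j M k) ≡ ((d + M) C j) * p (M + k) (M + k) i 0 * pˡ 1 (suc j) d d 0
∑seq-gapWeight d j M k i j+k≡d i≤M 1≤d = begin
    ∑seq (d + M) (range 0 (d + suc i)) (gapWeight d j M k)
  ≡⟨ ∑seq-splitWeight (d + M) d i j _ _ ⟩
    ((d + M) C j) * ∑seq j (range 0 d) (λ l → 𝟙 (flaws d (1 ∷ l) ≟ 0)) * ∑seq (d + M ∸ j) (range 0 i) (λ h → 𝟙 (flaws M h ≟ k))
  ≡⟨ cong₂ (λ x y → ((d + M) C j) * x * y) (sym (pˡ1≡∑seq j d d 0 ≤-refl 1≤d)) right-part ⟩
    ((d + M) C j) * pˡ 1 (suc j) d d 0 * p (M + k) (M + k) i 0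
  ≡⟨ swap-last ((d + M) C j) (pˡ 1 (suc j) d d 0) (p (M + k) (M + k) i 0) ⟩
    ((d + M) C j) * p (M + k) (M + k) i 0 * pˡ 1 (suc j) d d 0
  ∎
  where
  open ≡-Reasoning
  swap-last : ∀ a x y → a * x * y ≡ a * y * x
  swap-last = solve-∀
  right-cars : d + M ∸ j ≡ M + k
  right-cars = trans (cong (λ e → e + M ∸ j) (sym j+k≡d)) (trans (cong (_∸ j) (+-assoc j k M)) (trans (m+n∸m≡n j (k + M)) (+-comm k M)))
  right-part : ∑seq (d + M ∸ j) (range 0 i) (λ h → 𝟙 (flaws M h ≟ k)) ≡ p (M + k) (M + k) i 0
  right-part = begin
      ∑seq (d + M ∸ j) (range 0 i) (λ h → 𝟙 (flaws M h ≟ k))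
    ≡⟨ cong (λ N → ∑seq N (range 0 i) (λ h → 𝟙 (flaws M h ≟ k))) right-cars ⟩
      ∑seq (M + k) (range 0 i) (λ h → 𝟙 (flaws M h ≟ k))
    ≡⟨ ∑seq-cong-range (M + k) i (λ h h≤i ∣h∣ → k-flaws⇔parking-function M k h (All.map (λ x≤i → ≤-trans x≤i i≤M) h≤i) ∣h∣) ⟩
      ∑seq (M + k) (range 0 i) (λ h → 𝟙 (flaws (M + k) h ≟ 0))
    ≡⟨ p≡∑seq (M + k) (M + k) i 0 (≤-trans i≤M (m≤m+n M k)) ⟨
      p (M + k) (M + k) i 0
    ∎

-- Index arithmetic

-- Index i of the theorem corresponds to the last empty space being s − i.
summand : ℕ → ℕ → ℕ → ℕ → List ℕ → ℕ
summand n s k i = gapWeight (s ∸ i ∸ 1) (s ∸ i ∸ k ∸ 1) (n ∸ (s ∸ i)) k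

∸-by : ∀ {x} a b → x ≡ a + b → x ∸ a ≡ b
∸-by a b refl = m+n∸m≡n a b

index-decomposition : ∀ n s k i → i ≤ s ∸ k ∸ 1 → k + 1 ≤ s → s ≤ n → ∃₂ λ w v → s ≡ i + suc (k + w) × n ≡ s + v
index-decomposition n s k i i≤ k+1≤s s≤n = s ∸ k ∸ 1 ∸ i , n ∸ s , s≡ , sym (m+[n∸m]≡n s≤n)
  where
  open ≡-Reasoning
  rearrange : ∀ k w i → k + 1 + (w + i) ≡ i + suc (k + w)
  rearrange = solve-∀
  s≡ = begin
    s                                   ≡⟨ m+[n∸m]≡n k+1≤s ⟨
    k + 1 + (s ∸ (k + 1))               ≡⟨ cong (k + 1 +_) (∸-+-assoc s k 1) ⟨
    k + 1 + (s ∸ k ∸ 1)                 ≡⟨ cong (k + 1 +_) (m∸n+n≡m i≤) ⟨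
    k + 1 + (s ∸ k ∸ 1 ∸ i + i)         ≡⟨ rearrange k (s ∸ k ∸ 1 ∸ i) i ⟩
    i + suc (k + (s ∸ k ∸ 1 ∸ i))       ∎

module ByIndex (k w i v : ℕ) where
  private
    s = i + suc (k + w)
    n = s + v

  s∸i≡ : s ∸ i ≡ suc (k + w)
  s∸i≡ = m+n∸m≡n i (suc (k + w))

  d∸k≡ : suc (k + w) ∸ k ≡ suc w
  d∸k≡ = ∸-by k (suc w) (sym (+-suc k w))

  n∸d≡ : n ∸ suc (k + w) ≡ i + v
  n∸d≡ = ∸-by (suc (k + w)) (i + v) (eq k w i v)
    where
    eq : ∀ k w i v → i + suc (k + w) + v ≡ suc (k + w) + (i + v)
    eq = solve-∀

  n∸1≡ : n ∸ 1 ≡ k + w + (i + v)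
  n∸1≡ = ∸-by 1 (k + w + (i + v)) (eq k w i v)
    where
    eq : ∀ k w i v → i + suc (k + w) + v ≡ 1 + (k + w + (i + v))
    eq = solve-∀

  n+k∸s+i≡ : n + k ∸ s + i ≡ i + v + k
  n+k∸s+i≡ = trans (cong (_+ i) (∸-by s (v + k) (+-assoc s v k))) (eq v k i)
    where
    eq : ∀ v k i → v + k + i ≡ i + v + k
    eq = solve-∀

  s∸k∸i≡ : s ∸ k ∸ i ≡ suc w
  s∸k∸i≡ = trans (∸-+-assoc s k i) (∸-by (k + i) (suc w) (eq k w i))
    where
    eq : ∀ k w i → i + suc (k + w) ≡ k + i + suc w
    eq = solve-∀

  s≡ : s ≡ k + w + suc i
  s≡ = eq k w i
    where
    eq : ∀ k w i → i + suc (k + w) ≡ k + w + suc i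
    eq = solve-∀

index⇒gap : ∀ n s k i → 1 ≤ k → i ≤ s ∸ k ∸ 1 → k + 1 ≤ s → s ≤ n →
  1 ≤ s ∸ i ∸ 1 × s ∸ i ∸ k ∸ 1 + k ≡ s ∸ i ∸ 1 × n ≡ s ∸ i ∸ 1 + suc (n ∸ (s ∸ i))
index⇒gap n s k i 1≤k i≤ k+1≤s s≤n with index-decomposition n s k i i≤ k+1≤s s≤n
... | w , v , refl , refl rewrite ByIndex.s∸i≡ k w i v | ByIndex.d∸k≡ k w i v | ByIndex.n∸d≡ k w i v =
  ≤-trans 1≤k (m≤m+n k w) , +-comm w k , eq k w i v
  where
  eq : ∀ k w i v → i + suc (k + w) + v ≡ k + w + suc (i + v)
  eq = solve-∀

∑seq-summand : ∀ n s k i → 1 ≤ k → i ≤ s ∸ k ∸ 1 → k + 1 ≤ s → s ≤ n →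
  ∑seq (n ∸ 1) (range 0 s) (summand n s k i) ≡
    ((n ∸ 1) C (s ∸ i ∸ k ∸ 1)) * p (n + k ∸ s + i) (n + k ∸ s + i) i 0 * pˡ 1 (s ∸ k ∸ i) (s ∸ i ∸ 1) (s ∸ i ∸ 1) 0
∑seq-summand n s k i 1≤k i≤ k+1≤s s≤n with index-decomposition n s k i i≤ k+1≤s s≤n
... | w , v , refl , refl
  rewrite ByIndex.n∸1≡ k w i v | ByIndex.n+k∸s+i≡ k w i v | ByIndex.s∸k∸i≡ k w i v
        | ByIndex.s∸i≡ k w i v | ByIndex.d∸k≡ k w i v | ByIndex.n∸d≡ k w i v | ByIndex.s≡ k w i v =
  ∑seq-gapWeight (k + w) w (i + v) k i (+-comm w k) (m≤m+n i v) (≤-trans 1≤k (m≤m+n k w))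

module ByGap (j k z M : ℕ) where
  private
    d = j + k

  s∸d≡ : suc (d + z) ∸ d ≡ suc z
  s∸d≡ = ∸-by d (suc z) (sym (+-suc d z))

  s∸i≡ : suc (d + z) ∸ z ≡ suc d
  s∸i≡ = ∸-by z (suc d) (eq j k z)
    where
    eq : ∀ j k z → suc (j + k + z) ≡ z + suc (j + k)
    eq = solve-∀

  d∸k≡ : suc d ∸ k ≡ suc j
  d∸k≡ = ∸-by k (suc j) (eq j k)
    where
    eq : ∀ j k → suc (j + k) ≡ k + suc j
    eq = solve-∀

  n∸d≡ : d + suc M ∸ suc d ≡ M
  n∸d≡ = ∸-by (suc d) M (+-suc d M)

  s∸k≡ : suc (suc (d + z)) ∸ k ≡ suc (suc (j + z))
  s∸k≡ = ∸-by k (suc (suc (j + z))) (eq j k z)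
    where
    eq : ∀ j k z → suc (suc (j + k + z)) ≡ k + suc (suc (j + z))
    eq = solve-∀

gap⇒index : ∀ n s k d M j → n ≡ d + suc M → j + k ≡ d → 2 + d ≤ s →
  1 ≤ s ∸ suc d × s ∸ suc d ≤ s ∸ k ∸ 1 × summand n s k (s ∸ suc d) ≡ gapWeight d j M k
gap⇒index _ _ k _ M j refl refl 2+d≤s with m≤n⇒∃[o]m+o≡n 2+d≤s
... | z , refl rewrite ByGap.s∸d≡ j k z M | ByGap.s∸i≡ j k z M | ByGap.d∸k≡ j k z M | ByGap.n∸d≡ j k z M | ByGap.s∸k≡ j k z M =
  s≤s z≤n , s≤s (m≤n+m z j) , refl

index<s : ∀ s k i → i ≤ s ∸ k ∸ 1 → k + 1 ≤ s → i < s
index<s s k i i≤ k+1≤s = ≤-<-trans i≤ (subst (_< s) (sym (∸-+-assoc s k 1)) (∸-monoʳ-< (m≤n+m 1 k) k+1≤s))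

index≡ : ∀ s i d → i < s → s ∸ i ∸ 1 ≡ d → i ≡ s ∸ suc d
index≡ s i _ i<s refl = sym (trans (cong (s ∸_) suc[s∸i∸1]) (m∸[m∸n]≡n (<⇒≤ i<s)))
  where
  suc[s∸i∸1] : suc (s ∸ i ∸ 1) ≡ s ∸ i
  suc[s∸i∸1] = trans (+-comm 1 (s ∸ i ∸ 1)) (m∸n+n≡m (m<n⇒0<n∸m i<s))

-- Decomposing by the last empty space

summand-sound : ∀ n′ s k b i → 1 ≤ k → k + 1 ≤ s → s ≤ suc n′ → length b ≡ n′ → i ≤ s ∸ k ∸ 1 → summand (suc n′) s k i b ≢ 0 →
  flaws (suc n′) (1 ∷ b) ≡ k × ∃ λ x → length x ≡ s ∸ i ∸ 1 × parkAll (replicate (suc n′) false) (1 ∷ b) ≡ x ++ false ∷ replicate (suc n′ ∸ (s ∸ i)) true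
summand-sound n′ s k b i 1≤k k+1≤s s≤n ∣b∣ i≤ ≢0 with index⇒gap (suc n′) s k i 1≤k i≤ k+1≤s s≤n
... | 1≤d , j+k≡d , n≡ =
  subst (λ n → flaws n (1 ∷ b) ≡ k × ∃ λ x → length x ≡ d × parkAll (replicate n false) (1 ∷ b) ≡ x ++ false ∷ replicate M true) (sym n≡)
    (gapWeight-sound d j M k b 1≤d j+k≡d (suc-injective (trans (cong suc ∣b∣) (trans n≡ (+-suc d M)))) ≢0)
  where
  d = s ∸ i ∸ 1
  j = s ∸ i ∸ k ∸ 1
  M = suc n′ ∸ (s ∸ i)

𝟙flaws≡∑summand : ∀ n′ s k b → 1 ≤ k → k + 1 ≤ s → s ≤ suc n′ → All (_≤ s) b → length b ≡ n′ →
  𝟙 (flaws (suc n′) (1 ∷ b) ≟ k) ≡ ∑ (range 0 (s ∸ k ∸ 1)) (λ i → summand (suc n′) s k i b)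
𝟙flaws≡∑summand n′ s k b 1≤k k+1≤s s≤n b≤s ∣b∣ with flaws (suc n′) (1 ∷ b) ≟ k
... | no flaws≢k = trans (𝟙-no (flaws (suc n′) (1 ∷ b) ≟ k) flaws≢k)
  (sym (trans (∑-cong-range 0 (s ∸ k ∸ 1) (λ i _ i≤ → vanishes i i≤)) (∑-zero (range 0 (s ∸ k ∸ 1)))))
  where
  vanishes : ∀ i → i ≤ s ∸ k ∸ 1 → summand (suc n′) s k i b ≡ 0
  vanishes i i≤ with summand (suc n′) s k i b ≟ 0
  ... | yes ≡0 = ≡0
  ... | no  ≢0 = ⊥-elim (flaws≢k (proj₁ (summand-sound n′ s k b i 1≤k k+1≤s s≤n ∣b∣ i≤ ≢0)))
... | yes flaws≡k with gapWeight-complete n′ s k b 1≤k b≤s ∣b∣ flaws≡k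
...   | d , M , j , n≡ , j+k≡d , 2+d≤s , weight≡1 with gap⇒index (suc n′) s k d M j n≡ j+k≡d 2+d≤s
...     | 1≤i₀ , i₀≤ , summand≡ = trans (𝟙-yes (flaws (suc n′) (1 ∷ b) ≟ k) flaws≡k)
  (sym (trans (∑-single 0 (s ∸ k ∸ 1) _ i₀ 1≤i₀ i₀≤ others) (trans (cong (λ f → f b) summand≡) weight≡1)))
  where
  i₀ = s ∸ suc d
  last-empty-at-d : ∃ λ x → length x ≡ d × parkAll (replicate (suc n′) false) (1 ∷ b) ≡ x ++ false ∷ replicate M true
  last-empty-at-d = subst (λ n → ∃ λ x → length x ≡ d × parkAll (replicate n false) (1 ∷ b) ≡ x ++ false ∷ replicate M true) (sym n≡)
    (proj₂ (gapWeight-sound d j M k b (≤-trans 1≤k (subst (k ≤_) j+k≡d (m≤n+m k j))) j+k≡d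
      (suc-injective (trans (cong suc ∣b∣) (trans n≡ (+-suc d M)))) (λ w≡0 → 0≢1+n (trans (sym w≡0) weight≡1))))
  others : ∀ i → 0 < i → i ≤ s ∸ k ∸ 1 → i ≢ i₀ → summand (suc n′) s k i b ≡ 0
  others i _ i≤ i≢i₀ with summand (suc n′) s k i b ≟ 0
  ... | yes ≡0 = ≡0
  ... | no  ≢0 with summand-sound n′ s k b i 1≤k k+1≤s s≤n ∣b∣ i≤ ≢0 | last-empty-at-d
  ...   | _ , x , ∣x∣ , final≡ | x₀ , ∣x₀∣ , final≡₀ =
    ⊥-elim (i≢i₀ (index≡ s i d (index<s s k i i≤ k+1≤s)
      (trans (sym ∣x∣) (trans (lastEmpty-unique x x₀ _ M (trans (sym final≡) final≡₀)) ∣x₀∣))))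

theorem6p2 : (n s k : ℕ) → 1 ≤ k → k + 1 ≤ s → s ≤ n →
    pˡ 1 n n s k ≡
      Σ₁ (s ∸ k ∸ 1) (λ i →
        ((n ∸ 1) C (s ∸ i ∸ k ∸ 1))
        * p (n + k ∸ s + i) (n + k ∸ s + i) i 0
        * pˡ 1 (s ∸ k ∸ i) (s ∸ i ∸ 1) (s ∸ i ∸ 1) 0)
theorem6p2 zero     s k 1≤k k+1≤s s≤0 = ⊥-elim (n≮0 (≤-trans (m≤n+m 1 k) (≤-trans k+1≤s s≤0)))
theorem6p2 (suc n′) s k 1≤k k+1≤s s≤n = begin
    pˡ 1 n n s k
  ≡⟨ pˡ1≡∑seq n′ n s k s≤n (≤-trans (m≤n+m 1 k) k+1≤s) ⟩
    ∑seq n′ (range 0 s) (λ b → 𝟙 (flaws n (1 ∷ b) ≟ k))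
  ≡⟨ ∑seq-cong-range n′ s (λ b b≤s ∣b∣ → 𝟙flaws≡∑summand n′ s k b 1≤k k+1≤s s≤n b≤s ∣b∣) ⟩
    ∑seq n′ (range 0 s) (λ b → ∑ indices (λ i → summand n s k i b))
  ≡⟨ ∑seq-∑-swap n′ (range 0 s) indices (λ b i → summand n s k i b) ⟩
    ∑ indices (λ i → ∑seq n′ (range 0 s) (summand n s k i))
  ≡⟨ ∑-cong-range 0 (s ∸ k ∸ 1) (λ i _ i≤ → ∑seq-summand n s k i 1≤k i≤ k+1≤s s≤n) ⟩
    ∑ indices term
  ≡⟨ Σ₁≡∑-range (s ∸ k ∸ 1) term ⟨
    Σ₁ (s ∸ k ∸ 1) term
  ∎
  where
  open ≡-Reasoning
  n = suc n′
  indices = range 0 (s ∸ k ∸ 1)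
  term : ℕ → ℕ
  term i = ((n ∸ 1) C (s ∸ i ∸ k ∸ 1)) * p (n + k ∸ s + i) (n + k ∸ s + i) i 0 * pˡ 1 (s ∸ k ∸ i) (s ∸ i ∸ 1) (s ∸ i ∸ 1) 0
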